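{- For every odd positive integer $n$ and every even integer $d$ with $0 \le d \le n-1$ and $d \ne \frac{n-1}{2}$, there exists a $d$-regular graph on $n$ vertices that does not contain a $5$-cycle as an induced subgraph.
   Context: A graph is $d$-regular if every vertex has degree $d$. -}

module Defs where

open import Data.Nat using (ℕ; suc)
open import Data.Bool using (Bool; true; false; T)
open import Data.Fin using (Fin; zero; suc; toℕ)
open import Data.Fin.Properties using ()
open import Data.List using (List; length; filter)
open import Data.List.Base using ()
open import Data.Vec.Functional using ()
open import Data.Fin.Base using ()
open import Data.List using (allFin)
open import Relation.Binary.PropositionalEquality using (_≡_)
open import Relation.Nullary using (¬_)
open import Data.Product using (Σ; _×_)
open import Function.Definitions using (Injective)
open import Data.Bool.Properties using (T?)

record SimpleGraph (n : ℕ) : Set where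
  field
    Adj   : Fin n → Fin n → Bool
    sym   : ∀ u v → Adj u v ≡ Adj v u
    loopless : ∀ v → Adj v v ≡ false
open SimpleGraph public

degree : ∀ {n} → SimpleGraph n → Fin n → ℕ
degree {n} G v = length (filter (λ u → T? (Adj G v u)) (allFin n))

IsRegular : ∀ {n} → SimpleGraph n → ℕ → Set
IsRegular {n} G d = ∀ v → degree G v ≡ d

C5Adj : Fin 5 → Fin 5 → Bool
C5Adj zero (suc zero) = true
C5Adj (suc zero) zero = true
C5Adj (suc zero) (suc (suc zero)) = true
C5Adj (suc (suc zero)) (suc zero) = true
C5Adj (suc (suc zero)) (suc (suc (suc zero))) = true
C5Adj (suc (suc (suc zero))) (suc (suc zero)) = true
C5Adj (suc (suc (suc zero))) (suc (suc (suc (suc zero)))) = true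
C5Adj (suc (suc (suc (suc zero)))) (suc (suc (suc zero))) = true
C5Adj (suc (suc (suc (suc zero)))) zero = true
C5Adj zero (suc (suc (suc (suc zero)))) = true
C5Adj _ _ = false

HasInducedC5 : ∀ {n} → SimpleGraph n → Set
HasInducedC5 {n} G =
  Σ (Fin 5 → Fin n) λ f → Injective _≡_ _≡_ f × (∀ i j → Adj G (f i) (f j) ≡ C5Adj i j)

-- Induced-C5-freeness survives complementation (C5 is self-complementary) and
-- disjoint union (C5 is connected); complementation turns a d-regular graph on n
-- vertices into an (n - 1 - d)-regular one, and a disjoint union of d-regular graphs
-- is d-regular.  Starting from edgeless graphs these operations suffice.
-- On 2a vertices every degree d < 2a is reached by induction on a: for d ≥ a take the
-- complement of the graph of degree 2a - 1 - d < a; for d < a split the vertices into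
-- two halves of even order, except when a = d + 1 is odd, where 2a = (d + 1) + (d + 1)
-- is covered by two copies of K_(d+1).
-- On 2k + 1 vertices and degree 2m < k, add K_(2m+1) to a 2m-regular graph on the
-- remaining 2(k - m) vertices; for 2m > k pass to the complement, of degree
-- 2(k - m) < k.  Neither step applies when 2m = k.

module Submission where

open import Defs hiding (sym)
open import Data.Bool using (Bool; true; false; not; _∧_; if_then_else_)
import Data.Bool.Properties as Bool
open import Data.Bool.Properties using (T?; ∧-zeroʳ; ∧-identityʳ; not-involutive)
open import Data.Fin using (Fin; zero; suc; #_; _≟_; _↑ˡ_; _↑ʳ_; splitAt; join)
open import Data.Fin.Properties
  using (all?; ↑ˡ-injective; ↑ʳ-injective; splitAt-↑ˡ; splitAt-↑ʳ; splitAt⁻¹-↑ˡ; splitAt⁻¹-↑ʳ; join-splitAt)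
open import Data.List using (length; filter; tabulate)
open import Data.Nat using (ℕ; zero; suc; _+_; _*_; _≤_; _<_; _≤?_; z<s; s≤s)
open import Data.Nat.Induction using (<-rec)
open import Data.Nat.Properties
  using (+-suc; +-identityʳ; +-cancelˡ-≡; +-cancelˡ-<; +-monoˡ-<; suc-injective; <-cmp; ≰⇒>; <⇒≱; ≤-trans;
         n≤1+n; m≤m+n; m≤n+m; m<m+n; *-monoʳ-<; *-monoʳ-≤; *-cancelˡ-≤; m≤n⇒∃[o]m+o≡n)
open import Data.Nat.Tactic.RingSolver using (solve-∀)
open import Data.Product using (Σ; _×_; _,_; proj₁; proj₂; ∃)
open import Data.Sum using (_⊎_; inj₁; inj₂; [_,_]′)
open import Function using (_∘_; id; const; case_of_)
open import Function.Definitions using (Injective)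
open import Relation.Binary using (tri<; tri≈; tri>)
open import Relation.Binary.PropositionalEquality
open import Relation.Nullary using (¬_; yes; no; contradiction)
open import Relation.Nullary.Decidable using (does; dec-true; dec-false; from-yes; _→-dec_)

count : ∀ {n} → (Fin n → Bool) → ℕ
count {zero}  p = 0
count {suc n} p = if p zero then suc (count (p ∘ suc)) else count (p ∘ suc)

count-cong : ∀ {n} {p q : Fin n → Bool} → (∀ u → p u ≡ q u) → count p ≡ count q
count-cong {zero}  p≗q = refl
count-cong {suc n} p≗q rewrite p≗q zero | count-cong (p≗q ∘ suc) = refl

count-false : ∀ n → count {n} (const false) ≡ 0
count-false zero    = refl
count-false (suc n) = count-false n

count-not : ∀ {n} (p : Fin n → Bool) → count p + count (not ∘ p) ≡ n
count-not {zero}  p = refl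
count-not {suc n} p with p zero
... | true  = cong suc (count-not (p ∘ suc))
... | false = trans (+-suc _ _) (cong suc (count-not (p ∘ suc)))

count-remove : ∀ {n} (p : Fin n → Bool) v → p v ≡ true →
  suc (count (λ u → p u ∧ not (does (v ≟ u)))) ≡ count p
count-remove p zero pv rewrite pv =
  cong suc (count-cong (λ u → ∧-identityʳ (p (suc u))))
count-remove p (suc v) pv with p zero
... | true  = cong suc (count-remove (p ∘ suc) v pv)
... | false = count-remove (p ∘ suc) v pv

count-↑ : ∀ a {b} (p : Fin (a + b) → Bool) →
  count p ≡ count (p ∘ (_↑ˡ b)) + count (p ∘ (a ↑ʳ_))
count-↑ zero    p = refl
count-↑ (suc a) p with p zero
... | true  = cong suc (count-↑ a (p ∘ suc))
... | false = count-↑ a (p ∘ suc)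

length-filter-tabulate : ∀ {A : Set} {n} (p : A → Bool) (f : Fin n → A) →
  length (filter (T? ∘ p) (tabulate f)) ≡ count (p ∘ f)
length-filter-tabulate {n = zero}  p f = refl
length-filter-tabulate {n = suc n} p f with p (f zero)
... | true  = cong suc (length-filter-tabulate p (f ∘ suc))
... | false = length-filter-tabulate p (f ∘ suc)

degree≡count : ∀ {n} (G : SimpleGraph n) v → degree G v ≡ count (Adj G v)
degree≡count G v = length-filter-tabulate (Adj G v) id

does-≟-sym : ∀ {n} (u v : Fin n) → does (u ≟ v) ≡ does (v ≟ u)
does-≟-sym u v with u ≟ v
... | yes u≡v = sym (dec-true (v ≟ u) (sym u≡v))
... | no  u≢v = sym (dec-false (v ≟ u) (u≢v ∘ sym))

does-≟-injective : ∀ {m n} {f : Fin m → Fin n} → Injective _≡_ _≡_ f →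
  ∀ x y → does (f x ≟ f y) ≡ does (x ≟ y)
does-≟-injective {f = f} f-inj x y with x ≟ y
... | yes refl = dec-true (f x ≟ f x) refl
... | no  x≢y  = dec-false (f x ≟ f y) (x≢y ∘ f-inj)

complement : ∀ {n} → SimpleGraph n → SimpleGraph n
complement G = record
  { Adj      = λ u v → not (Adj G u v) ∧ not (does (u ≟ v))
  ; sym      = λ u v → cong₂ (λ x y → not x ∧ not y) (SimpleGraph.sym G u v) (does-≟-sym u v)
  ; loopless = λ v → trans (cong (λ y → not (Adj G v v) ∧ not y) (dec-true (v ≟ v) refl)) (∧-zeroʳ _)
  }

complement-involutive : ∀ {n} (G : SimpleGraph n) u v →
  Adj (complement (complement G)) u v ≡ Adj G u v
complement-involutive G u v with u ≟ v
... | yes refl = trans (∧-zeroʳ _) (sym (loopless G u))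
... | no  _    = trans (∧-identityʳ _) (trans (cong not (∧-identityʳ _)) (not-involutive _))

degree-complement : ∀ {n} (G : SimpleGraph n) v → degree G v + suc (degree (complement G) v) ≡ n
degree-complement {n} G v = begin
  degree G v + suc (degree (complement G) v)
    ≡⟨ cong₂ (λ x y → x + suc y) (degree≡count G v) (degree≡count (complement G) v) ⟩
  count (Adj G v) + suc (count (Adj (complement G) v))
    ≡⟨ cong (count (Adj G v) +_) (count-remove (not ∘ Adj G v) v (cong not (loopless G v))) ⟩
  count (Adj G v) + count (not ∘ Adj G v)
    ≡⟨ count-not (Adj G v) ⟩
  n ∎
  where open ≡-Reasoning

complement-regular : ∀ {n d e} {G : SimpleGraph n} → suc (d + e) ≡ n →
  IsRegular G d → IsRegular (complement G) e
complement-regular {n} {d} {e} {G} n≡1+d+e G-reg v = suc-injective (+-cancelˡ-≡ d _ _ (begin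
  d + suc (degree (complement G) v)           ≡⟨ cong (_+ _) (G-reg v) ⟨
  degree G v + suc (degree (complement G) v)  ≡⟨ degree-complement G v ⟩
  n                                           ≡⟨ n≡1+d+e ⟨
  suc (d + e)                                 ≡⟨ +-suc d e ⟨
  d + suc e                                   ∎))
  where open ≡-Reasoning

record _↪_ {m n} (H : SimpleGraph m) (G : SimpleGraph n) : Set where
  constructor embedding
  field
    map       : Fin m → Fin n
    injective : Injective _≡_ _≡_ map
    adj       : ∀ x y → Adj G (map x) (map y) ≡ Adj H x y
open _↪_

↪-trans : ∀ {l m n} {H : SimpleGraph l} {G : SimpleGraph m} {K : SimpleGraph n} →
  H ↪ G → G ↪ K → H ↪ K
↪-trans (embedding f f-inj f-adj) (embedding g g-inj g-adj) =
  embedding (g ∘ f) (f-inj ∘ g-inj) (λ x y → trans (g-adj (f x) (f y)) (f-adj x y))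

↪-factor : ∀ {l m n} {H : SimpleGraph l} {G : SimpleGraph m} {K : SimpleGraph n} →
  (e : G ↪ K) (f : H ↪ K) → (∀ x → ∃ λ y → map e y ≡ map f x) → H ↪ G
↪-factor {l} {m} {H = H} {G} {K} (embedding e e-inj e-adj) (embedding f f-inj f-adj) covered =
  embedding g g-inj g-adj
  where
  g : Fin l → Fin m
  g x = proj₁ (covered x)
  e∘g≡f : ∀ x → e (g x) ≡ f x
  e∘g≡f x = proj₂ (covered x)
  g-inj : Injective _≡_ _≡_ g
  g-inj {x} {y} gx≡gy = f-inj (trans (sym (e∘g≡f x)) (trans (cong e gx≡gy) (e∘g≡f y)))
  g-adj : ∀ x y → Adj G (g x) (g y) ≡ Adj H x y
  g-adj x y = trans (sym (e-adj (g x) (g y))) (trans (cong₂ (Adj K) (e∘g≡f x) (e∘g≡f y)) (f-adj x y))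

↪-complement : ∀ {m n} {H : SimpleGraph m} {G : SimpleGraph n} →
  H ↪ G → complement H ↪ complement G
↪-complement (embedding f f-inj f-adj) = embedding f f-inj
  (λ x y → cong₂ (λ a b → not a ∧ not b) (f-adj x y) (does-≟-injective f-inj x y))

complement²↪ : ∀ {n} (G : SimpleGraph n) → complement (complement G) ↪ G
complement²↪ G = embedding id id (λ x y → sym (complement-involutive G x y))

C5 : SimpleGraph 5
C5 = record
  { Adj      = C5Adj
  ; sym      = from-yes (all? λ i → all? λ j → C5Adj i j Bool.≟ C5Adj j i)
  ; loopless = from-yes (all? λ i → C5Adj i i Bool.≟ false)
  }

-- σ i = 2 i mod 5 maps the cycle i ~ i ± 1 onto its complement i ~ i ± 2.
σ : Fin 5 → Fin 5
σ zero                         = zero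
σ (suc zero)                   = suc (suc zero)
σ (suc (suc zero))             = suc (suc (suc (suc zero)))
σ (suc (suc (suc zero)))       = suc zero
σ (suc (suc (suc (suc zero)))) = suc (suc (suc zero))

HasInducedC5⇒C5↪ : ∀ {n} {G : SimpleGraph n} → HasInducedC5 G → C5 ↪ G
HasInducedC5⇒C5↪ (f , f-inj , f-adj) = embedding f f-inj f-adj

C5↪⇒HasInducedC5 : ∀ {n} {G : SimpleGraph n} → C5 ↪ G → HasInducedC5 G
C5↪⇒HasInducedC5 (embedding f f-inj f-adj) = f , f-inj , f-adj

C5↪complement-C5 : C5 ↪ complement C5
C5↪complement-C5 = embedding σ
  (λ {i} {j} → from-yes (all? λ i → all? λ j → (σ i ≟ σ j) →-dec (i ≟ j)) i j)
  (from-yes (all? λ i → all? λ j → Adj (complement C5) (σ i) (σ j) Bool.≟ C5Adj i j))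

complement-C5-free : ∀ {n} {G : SimpleGraph n} → ¬ HasInducedC5 G → ¬ HasInducedC5 (complement G)
complement-C5-free {G = G} C5-free C5↪Gᶜ = C5-free (C5↪⇒HasInducedC5
  (↪-trans (↪-trans C5↪complement-C5 (↪-complement (HasInducedC5⇒C5↪ {G = complement G} C5↪Gᶜ)))
           (complement²↪ G)))

C5-connected : ∀ {A : Set} (c : Fin 5 → A) → (∀ i j → C5Adj i j ≡ true → c i ≡ c j) →
  ∀ i → c i ≡ c zero
C5-connected c edge zero                         = refl
C5-connected c edge (suc zero)                   = edge (# 1) (# 0) refl
C5-connected c edge (suc (suc zero))             = trans (edge (# 2) (# 1) refl) (edge (# 1) (# 0) refl)
C5-connected c edge (suc (suc (suc zero)))       = trans (edge (# 3) (# 4) refl) (edge (# 4) (# 0) refl)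
C5-connected c edge (suc (suc (suc (suc zero)))) = edge (# 4) (# 0) refl

isInj₁ : ∀ {A B : Set} → A ⊎ B → Bool
isInj₁ = [ const true , const false ]′

module _ {a b : ℕ} (G : SimpleGraph a) (H : SimpleGraph b) where

  ⊎-adj : Fin a ⊎ Fin b → Fin a ⊎ Fin b → Bool
  ⊎-adj (inj₁ x) (inj₁ y) = Adj G x y
  ⊎-adj (inj₂ x) (inj₂ y) = Adj H x y
  ⊎-adj _        _        = false

  ⊎-adj-sym : ∀ s t → ⊎-adj s t ≡ ⊎-adj t s
  ⊎-adj-sym (inj₁ x) (inj₁ y) = SimpleGraph.sym G x y
  ⊎-adj-sym (inj₁ x) (inj₂ y) = refl
  ⊎-adj-sym (inj₂ x) (inj₁ y) = refl
  ⊎-adj-sym (inj₂ x) (inj₂ y) = SimpleGraph.sym H x y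

  ⊎-loopless : ∀ s → ⊎-adj s s ≡ false
  ⊎-loopless (inj₁ x) = loopless G x
  ⊎-loopless (inj₂ x) = loopless H x

  ⊎-adj⇒same-side : ∀ s t → ⊎-adj s t ≡ true → isInj₁ s ≡ isInj₁ t
  ⊎-adj⇒same-side (inj₁ x) (inj₁ y) _ = refl
  ⊎-adj⇒same-side (inj₂ x) (inj₂ y) _ = refl

  _⊕_ : SimpleGraph (a + b)
  _⊕_ = record
    { Adj      = λ u v → ⊎-adj (splitAt a u) (splitAt a v)
    ; sym      = λ u v → ⊎-adj-sym (splitAt a u) (splitAt a v)
    ; loopless = λ v → ⊎-loopless (splitAt a v)
    }

module _ {a b : ℕ} {G : SimpleGraph a} {H : SimpleGraph b} where

  ⊕-adj-ˡˡ : ∀ x y → Adj (G ⊕ H) (x ↑ˡ b) (y ↑ˡ b) ≡ Adj G x y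
  ⊕-adj-ˡˡ x y rewrite splitAt-↑ˡ a x b | splitAt-↑ˡ a y b = refl

  ⊕-adj-ˡʳ : ∀ x y → Adj (G ⊕ H) (x ↑ˡ b) (a ↑ʳ y) ≡ false
  ⊕-adj-ˡʳ x y rewrite splitAt-↑ˡ a x b | splitAt-↑ʳ a b y = refl

  ⊕-adj-ʳˡ : ∀ x y → Adj (G ⊕ H) (a ↑ʳ x) (y ↑ˡ b) ≡ false
  ⊕-adj-ʳˡ x y rewrite splitAt-↑ʳ a b x | splitAt-↑ˡ a y b = refl

  ⊕-adj-ʳʳ : ∀ x y → Adj (G ⊕ H) (a ↑ʳ x) (a ↑ʳ y) ≡ Adj H x y
  ⊕-adj-ʳʳ x y rewrite splitAt-↑ʳ a b x | splitAt-↑ʳ a b y = refl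

  ↪-⊕ˡ : G ↪ (G ⊕ H)
  ↪-⊕ˡ = embedding (_↑ˡ b) (↑ˡ-injective b _ _) ⊕-adj-ˡˡ

  ↪-⊕ʳ : H ↪ (G ⊕ H)
  ↪-⊕ʳ = embedding (a ↑ʳ_) (↑ʳ-injective a _ _) ⊕-adj-ʳʳ

  degree-⊕ˡ : ∀ x → degree (G ⊕ H) (x ↑ˡ b) ≡ degree G x
  degree-⊕ˡ x = begin
    degree (G ⊕ H) (x ↑ˡ b)
      ≡⟨ trans (degree≡count (G ⊕ H) (x ↑ˡ b)) (count-↑ a (Adj (G ⊕ H) (x ↑ˡ b))) ⟩
    count (Adj (G ⊕ H) (x ↑ˡ b) ∘ (_↑ˡ b)) + count (Adj (G ⊕ H) (x ↑ˡ b) ∘ (a ↑ʳ_))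
      ≡⟨ cong₂ _+_ (count-cong (⊕-adj-ˡˡ x)) (trans (count-cong (⊕-adj-ˡʳ x)) (count-false b)) ⟩
    count (Adj G x) + 0
      ≡⟨ trans (+-identityʳ _) (sym (degree≡count G x)) ⟩
    degree G x ∎
    where open ≡-Reasoning

  degree-⊕ʳ : ∀ y → degree (G ⊕ H) (a ↑ʳ y) ≡ degree H y
  degree-⊕ʳ y = begin
    degree (G ⊕ H) (a ↑ʳ y)
      ≡⟨ trans (degree≡count (G ⊕ H) (a ↑ʳ y)) (count-↑ a (Adj (G ⊕ H) (a ↑ʳ y))) ⟩
    count (Adj (G ⊕ H) (a ↑ʳ y) ∘ (_↑ˡ b)) + count (Adj (G ⊕ H) (a ↑ʳ y) ∘ (a ↑ʳ_))
      ≡⟨ cong₂ _+_ (trans (count-cong (⊕-adj-ʳˡ y)) (count-false a)) (count-cong (⊕-adj-ʳʳ y)) ⟩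
    0 + count (Adj H y)
      ≡⟨ sym (degree≡count H y) ⟩
    degree H y ∎
    where open ≡-Reasoning

  ⊕-regular : ∀ {d} → IsRegular G d → IsRegular H d → IsRegular (G ⊕ H) d
  ⊕-regular {d} G-reg H-reg u =
    subst (λ v → degree (G ⊕ H) v ≡ d) (join-splitAt a b u) (regular-at (splitAt a u))
    where
    regular-at : ∀ s → degree (G ⊕ H) (join a b s) ≡ d
    regular-at (inj₁ x) = trans (degree-⊕ˡ x) (G-reg x)
    regular-at (inj₂ y) = trans (degree-⊕ʳ y) (H-reg y)

  ↑ˡ-preimage : ∀ u → isInj₁ (splitAt a {b} u) ≡ true → ∃ λ x → x ↑ˡ b ≡ u
  ↑ˡ-preimage u left with splitAt a {b} u in eq
  ... | inj₁ x = x , splitAt⁻¹-↑ˡ eq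

  ↑ʳ-preimage : ∀ u → isInj₁ (splitAt a {b} u) ≡ false → ∃ λ y → a ↑ʳ y ≡ u
  ↑ʳ-preimage u right with splitAt a {b} u in eq
  ... | inj₂ y = y , splitAt⁻¹-↑ʳ eq

  ⊕-C5-side : (f : C5 ↪ (G ⊕ H)) →
    ∀ i → isInj₁ (splitAt a {b} (map f i)) ≡ isInj₁ (splitAt a {b} (map f zero))
  ⊕-C5-side f = C5-connected (λ i → isInj₁ (splitAt a {b} (map f i))) λ i j i~j →
    ⊎-adj⇒same-side G H (splitAt a {b} (map f i)) (splitAt a {b} (map f j)) (trans (adj f i j) i~j)

  ⊕-C5 : C5 ↪ (G ⊕ H) → C5 ↪ G ⊎ C5 ↪ H
  ⊕-C5 f with isInj₁ (splitAt a {b} (map f zero)) in f₀-side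
  ... | true  = inj₁ (↪-factor ↪-⊕ˡ f (λ i → ↑ˡ-preimage (map f i) (trans (⊕-C5-side f i) f₀-side)))
  ... | false = inj₂ (↪-factor ↪-⊕ʳ f (λ i → ↑ʳ-preimage (map f i) (trans (⊕-C5-side f i) f₀-side)))

  ⊕-C5-free : ¬ HasInducedC5 G → ¬ HasInducedC5 H → ¬ HasInducedC5 (G ⊕ H)
  ⊕-C5-free G-free H-free C5↪G⊕H with ⊕-C5 (HasInducedC5⇒C5↪ C5↪G⊕H)
  ... | inj₁ C5↪G = G-free (C5↪⇒HasInducedC5 C5↪G)
  ... | inj₂ C5↪H = H-free (C5↪⇒HasInducedC5 C5↪H)

C5FreeRegular : ℕ → ℕ → Set
C5FreeRegular n d = Σ (SimpleGraph n) λ G → IsRegular G d × ¬ HasInducedC5 G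

edgeless : ∀ n → SimpleGraph n
edgeless n = record { Adj = λ _ _ → false ; sym = λ _ _ → refl ; loopless = λ _ → refl }

C5FreeRegular-edgeless : ∀ n → C5FreeRegular n 0
C5FreeRegular-edgeless n =
  edgeless n
  , (λ v → trans (degree≡count (edgeless n) v) (count-false n))
  , λ { (_ , _ , f-adj) → contradiction (f-adj (# 0) (# 1)) λ () }

C5FreeRegular-complement : ∀ {n d e} → suc (d + e) ≡ n → C5FreeRegular n d → C5FreeRegular n e
C5FreeRegular-complement n≡1+d+e (G , G-reg , G-free) =
  complement G , complement-regular {G = G} n≡1+d+e G-reg , complement-C5-free {G = G} G-free

C5FreeRegular-complete : ∀ d → C5FreeRegular (suc d) d
C5FreeRegular-complete d = C5FreeRegular-complement refl (C5FreeRegular-edgeless (suc d))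

C5FreeRegular-⊕ : ∀ {a b n d} → C5FreeRegular a d → C5FreeRegular b d → a + b ≡ n → C5FreeRegular n d
C5FreeRegular-⊕ (G , G-reg , G-free) (H , H-reg , H-free) refl =
  G ⊕ H , ⊕-regular G-reg H-reg , ⊕-C5-free {G = G} {H} G-free H-free

data Halving : ℕ → Set where
  even : ∀ h → Halving (2 * h)
  odd  : ∀ h → Halving (suc (2 * h))

halve : ∀ n → Halving n
halve zero = even 0
halve (suc n) with halve n
... | even h = odd h
... | odd  h = subst Halving (cong suc (+-suc h (h + 0))) (even (suc h))

m<2*n⇒n<2*n : ∀ {m n} → m < 2 * n → n < 2 * n
m<2*n⇒n<2*n {n = suc n} _ = m<m+n (suc n) z<s

m+n<2*m⇒n<m : ∀ {m n} → m + n < 2 * m → n < m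
m+n<2*m⇒n<m {m} {n} m+n<2m = subst (n <_) (+-identityʳ m) (+-cancelˡ-< m n (m + 0) m+n<2m)

EvenOrderC5FreeRegular : ℕ → Set
EvenOrderC5FreeRegular a = ∀ d → d < 2 * a → C5FreeRegular (2 * a) d

even-order-sparse : ∀ {a d} → (∀ {h} → h < a → EvenOrderC5FreeRegular h) → d < a → C5FreeRegular (2 * a) d
even-order-sparse {a} {d} rec d<a with halve a
... | even h = C5FreeRegular-⊕ (rec h<2h d d<a) (rec h<2h d d<a) (size h)
  where
  h<2h : h < 2 * h
  h<2h = m<2*n⇒n<2*n d<a
  size : ∀ h → 2 * h + 2 * h ≡ 2 * (2 * h)
  size = solve-∀
... | odd h with <-cmp d (2 * h)
...   | tri< d<2h _ _ =
  C5FreeRegular-⊕ (rec (s≤s (m≤m+n h (h + 0))) d d<2h)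
                  (rec (s≤s (m<2*n⇒n<2*n d<2h)) d (≤-trans d<2h (*-monoʳ-≤ 2 (n≤1+n h))))
                  (size h)
  where
  size : ∀ h → 2 * h + 2 * suc h ≡ 2 * suc (2 * h)
  size = solve-∀
...   | tri≈ _ refl _ =
  C5FreeRegular-⊕ (C5FreeRegular-complete d) (C5FreeRegular-complete d) (size d)
  where
  size : ∀ d → suc d + suc d ≡ 2 * suc d
  size = solve-∀
...   | tri> _ _ 2h<d = contradiction 2h<d (<⇒≱ d<a)

even-order-dense : ∀ {a d} → (∀ {h} → h < a → EvenOrderC5FreeRegular h) → a ≤ d → d < 2 * a →
  C5FreeRegular (2 * a) d
even-order-dense {a} rec a≤d d<2a with m≤n⇒∃[o]m+o≡n a≤d
... | t , refl with m≤n⇒∃[o]m+o≡n (m+n<2*m⇒n<m {a} {t} d<2a)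
...   | e , refl =
  C5FreeRegular-complement (size t e) (even-order-sparse rec (s≤s (m≤n+m e t)))
  where
  size : ∀ t e → suc (e + (suc t + e + t)) ≡ 2 * (suc t + e)
  size = solve-∀

even-order : ∀ a → EvenOrderC5FreeRegular a
even-order = <-rec EvenOrderC5FreeRegular λ a rec d d<2a → case a ≤? d of λ where
  (yes a≤d) → even-order-dense rec a≤d d<2a
  (no  a≰d) → even-order-sparse rec (≰⇒> a≰d)

odd-order-sparse : ∀ {k m} → 2 * m < k → C5FreeRegular (2 * k + 1) (2 * m)
odd-order-sparse {m = m} 2m<k with m≤n⇒∃[o]m+o≡n 2m<k
... | s , refl = C5FreeRegular-⊕ (C5FreeRegular-complete (2 * m))
  (even-order (suc (m + s)) (2 * m) (*-monoʳ-< 2 (s≤s (m≤m+n m s))))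
  (size m s)
  where
  size : ∀ m s → suc (2 * m) + 2 * suc (m + s) ≡ 2 * (suc (2 * m) + s) + 1
  size = solve-∀

odd-order-dense : ∀ {k m} → k < 2 * m → m ≤ k → C5FreeRegular (2 * k + 1) (2 * m)
odd-order-dense {m = m} k<2m m≤k with m≤n⇒∃[o]m+o≡n m≤k
... | t , refl = C5FreeRegular-complement (size m t) (odd-order-sparse {m = t} 2t<m+t)
  where
  2t<m+t : 2 * t < m + t
  2t<m+t = subst (_< m + t) (cong (t +_) (sym (+-identityʳ t))) (+-monoˡ-< t (m+n<2*m⇒n<m k<2m))
  size : ∀ m t → suc (2 * t + 2 * m) ≡ 2 * (m + t) + 1
  size = solve-∀

lemma6 : (k m : ℕ) → 2 * m ≤ 2 * k → ¬ (2 * m ≡ k) →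
    Σ (SimpleGraph (2 * k + 1)) λ G → IsRegular G (2 * m) × ¬ HasInducedC5 G
lemma6 k m 2m≤2k 2m≢k with <-cmp (2 * m) k
... | tri< 2m<k _ _ = odd-order-sparse {m = m} 2m<k
... | tri≈ _ 2m≡k _ = contradiction 2m≡k 2m≢k
... | tri> _ _ k<2m = odd-order-dense {m = m} k<2m (*-cancelˡ-≤ 2 2m≤2k)
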